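{- Let $r\ge 2$ and $n\ge 1$. Whatever families $\mathcal F_1,\dots,\mathcal F_{r-1}$ the Questioner poses in rounds $1,\dots,r-1$ (each chosen depending on earlier answers), an Adversary can answer them round by round (answers in round $t$ depending only on $\mathcal F_1,\dots,\mathcal F_t$ and earlier answers) in such a way that for every $1\le t\le r-1$ at least one of the following holds: (i) $n_t\le m_t-1$; or (ii) all answers in the first $t$ rounds are "no" and $|G_t|\le n-n_t$.
   Context: Setting: $[n]=\{1,\dots,n\}$. In round $t$ the Questioner poses a finite family $\mathcal F_t$ of subsets of $[n]$, and each query receives the answer "yes" or "no" (here chosen by an Adversary). Notation: $k_t=|\mathcal F_t|$; $\mathcal F_t^Y$ and $\mathcal F_t^N=\mathcal F_t\setminus\mathcal F_t^Y$ are the queries of round $t$ answered yes and no, respectively; $G_0=\emptyset$ and $G_t=\bigcup\{F: F\in \mathcal F_j^N \text{ for some } j\le t\}$; $\mathcal G_t=\{F\setminus G_t : F\in\mathcal F_j^Y \text{ for some } j\le t\}$; $m_t=\min\{|B|:B\in\mathcal G_t\}$ (the size of a smallest member of $\mathcal G_t$); $n_0=n$ and $n_t=\lfloor n_{t-1}/(k_t+1)\rfloor$. Standing convention of the paper: every member of $\mathcal F_t$ is a subset of $[n]\setminus G_{t-1}$. -}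

module Defs where

open import Data.Bool using (Bool; true; false)
open import Data.Nat using (ℕ; zero; suc; _+_; _∸_; _≤_; _<_)
open import Data.Nat.DivMod using (_/_)
open import Data.Fin.Subset using (Subset; ⊥; ∁; _∪_; _─_; _⊆_; ∣_∣)
open import Data.List using (List; []; _∷_; _∷ʳ_; length; map; zip; concat; foldr; filter)
open import Data.List.Relation.Unary.All using (All)
open import Data.List.Relation.Unary.Unique.Propositional using (Unique)
open import Data.List.Membership.Propositional using (_∈_)
open import Data.Vec using (Vec; toList)
open import Data.Maybe using (Maybe; just; nothing)
open import Data.Product using (Σ; _×_; proj₁; proj₂)
open import Data.Sum using (_⊎_)
open import Data.Unit using (⊤)
open import Relation.Binary.PropositionalEquality using (_≡_)

-- A round: the posed family F_t (as a list of subsets of [n] = Fin n),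
-- each query paired with its answer (true = "yes", false = "no").
Round : ℕ → Set
Round n = List (Subset n × Bool)

History : ℕ → Set
History n = List (Round n)

allQA : ∀ {n} → History n → List (Subset n × Bool)
allQA h = concat h

noQueries : ∀ {n} → History n → List (Subset n)
noQueries h = Data.List.map proj₁ (filter (λ p → Data.Bool._≟_ (proj₂ p) false) (allQA h))
  where import Data.Bool

yesQueries : ∀ {n} → History n → List (Subset n)
yesQueries h = Data.List.map proj₁ (filter (λ p → Data.Bool._≟_ (proj₂ p) true) (allQA h))
  where import Data.Bool

Gset : ∀ {n} → History n → Subset n
Gset h = foldr _∪_ ⊥ (noQueries h)

calG : ∀ {n} → History n → List (Subset n)
calG h = map (λ F → F ─ Gset h) (yesQueries h)

minimumM : List ℕ → Maybe ℕ
minimumM [] = nothing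
minimumM (x ∷ xs) with minimumM xs
... | nothing = just x
... | just y = just (Data.Nat._⊓_ x y)
  where import Data.Nat

-- m_t : size of a smallest member of 𝒢_t (undefined = nothing if 𝒢_t = ∅)
mOf : ∀ {n} → History n → Maybe ℕ
mOf h = minimumM (map ∣_∣ (calG h))

-- n_t : starting from n_0 = m, n_t = ⌊ n_{t-1} / (k_t + 1) ⌋, k_t = |F_t|
nAfter : ∀ {n} → ℕ → History n → ℕ
nAfter m [] = m
nAfter m (R ∷ h) = nAfter (m / suc (length R)) h

AllNo : ∀ {n} → History n → Set
AllNo h = All (All (λ p → proj₂ p ≡ false)) h

-- The adversary's target after t rounds (history h of length t):
-- (i)  n_t ≤ m_t - 1  (m_t defined, i.e. 𝒢_t ≠ ∅; integer reading: n_t < m_t), or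
-- (ii) all answers "no" and |G_t| ≤ n - n_t.
Good : ∀ n → History n → Set
Good n h =
  (Σ ℕ λ m → (mOf h ≡ just m) × (nAfter n h < m))
  ⊎ (AllNo h × (∣ Gset h ∣ ≤ n ∸ nAfter n h))

-- Standing convention: F_t is a finite family (no repeated members) of
-- subsets of [n] ∖ G_{t-1}.
ValidFamily : ∀ {n} → History n → List (Subset n) → Set
ValidFamily h F = Unique F × All (λ A → A ⊆ ∁ (Gset h)) F

-- The adversary can survive k more rounds from history h: whatever valid
-- family F the Questioner poses next (depending on h), the Adversary chooses
-- answers (depending on h and F) so that the target holds after this round
-- and it can continue for the remaining rounds.
AdvWins : ∀ n → History n → ℕ → Set
AdvWins n h zero = ⊤
AdvWins n h (suc k) =
  (F : List (Subset n)) → ValidFamily h F →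
  Σ (Vec Bool (length F)) λ ans →
    let h' = h ∷ʳ zip F (toList ans) in
    Good n h' × AdvWins n h' k

-- The Adversary maintains the invariant that every set B answered "yes" has more
-- than n_t points outside G_t, so (i) holds as soon as one answer is "yes".
-- Given F_{t+1} with k queries, put d = ⌊n_t/(k+1)⌋ and enlarge U ⊇ G_t greedily
-- by any query A with 0 < |A ∖ U| ≤ d. Each step adds at most d points and covers
-- one more query, so |U| + d·#{A ∈ F : A ⊈ U} never grows; the final U has
-- |U| ≤ |G_t| + dk and contains every query A with |A ∖ U| ≤ d. Answer A "yes"
-- iff |A ∖ U| > d. Then G_{t+1} ⊆ U, so new yes-sets keep more than d = n_{t+1}
-- points outside G_{t+1}, while an old yes-set loses at most |G_{t+1}| − |G_t| ≤ dk
-- of its more than n_t ≥ d(k+1) points. If every answer so far is "no", then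
-- |G_{t+1}| ≤ |G_t| + dk ≤ n − n_t + dk ≤ n − d.
module Submission where

open import Defs
open import Data.Bool using (Bool; true; false)
import Data.Bool as Bool
open import Data.Bool.Properties using (¬-not)
open import Data.Empty using (⊥-elim)
open import Data.Fin.Subset using (Subset; inside; outside; _∈_; _⊆_; _∪_; _─_; ⋃; ∣_∣)
open import Data.Fin.Subset.Properties
  using ( _∈?_; ∉⊥; ∣⊥∣≡0; ∣⁅x⁆∣≡1; x∈⁅y⁆⇒x≡y; x∈p∧x∉q⇒x∈p─q; x∈p∪q⁻; p⊆p∪q; q⊆p∪q
        ; ⊆-refl; ⊆-trans; ⊆-antisym; p⊆q⇒∣p∣≤∣q∣; p─q─r≡p─q∪r; ∣p─q∣≤∣p∣)
open import Data.List using (List; []; _∷_; _∷ʳ_; _++_; [_]; length; map; zip; concat; filter)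
open import Data.List.Properties using (concat-++; ++-identityʳ; length-map)
open import Data.List.Membership.Propositional using (find; lose) renaming (_∈_ to _∈ˡ_)
open import Data.List.Membership.Propositional.Properties
  using (∈-map⁺; ∈-map⁻; ∈-filter⁺; ∈-filter⁻; ∈-++⁺ˡ; ∈-++⁺ʳ; ∈-++⁻)
open import Data.List.Relation.Unary.All as All using (All; []; _∷_)
open import Data.List.Relation.Unary.All.Properties using (map⁺; ∷ʳ⁺)
open import Data.List.Relation.Unary.Any using (here; there; any?)
open import Data.Maybe using (just; nothing)
open import Data.Nat
open import Data.Nat.DivMod using (m/n*n≤m; m/n≤m)
open import Data.Nat.Properties
open import Data.Product using (∃-syntax; _×_; _,_; proj₁; proj₂)
open import Data.Sum using (_⊎_; inj₁; inj₂; [_,_]′)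
open import Data.Unit using (tt)
open import Data.Vec as Vec using (Vec; []; _∷_; toList; fromList)
open import Data.Vec.Properties using (toList-map; toList∘fromList)
open import Function using (_∘_)
open import Relation.Nullary using (¬_; Dec; yes; no; does; contradiction)
open import Relation.Nullary.Decidable using (_×-dec_)
open import Relation.Binary.PropositionalEquality using (_≡_; refl; sym; trans; cong; subst; module ≡-Reasoning)

private
  variable
    n : ℕ
    p q r : Subset n
    As : List (Subset n)

∪-least : p ⊆ r → q ⊆ r → p ∪ q ⊆ r
∪-least {p = p} {q = q} p⊆r q⊆r x∈p∪q = [ p⊆r , q⊆r ]′ (x∈p∪q⁻ p q x∈p∪q)

p⊆q⇒p∪q≡q : p ⊆ q → p ∪ q ≡ q
p⊆q⇒p∪q≡q {p = p} {q = q} p⊆q = ⊆-antisym (∪-least p⊆q ⊆-refl) (q⊆p∪q p q)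

∣p─q∣+∣q∣≡∣p∪q∣ : (p q : Subset n) → ∣ p ─ q ∣ + ∣ q ∣ ≡ ∣ p ∪ q ∣
∣p─q∣+∣q∣≡∣p∪q∣ []            []            = refl
∣p─q∣+∣q∣≡∣p∪q∣ (inside  ∷ p) (outside ∷ q) = cong suc (∣p─q∣+∣q∣≡∣p∪q∣ p q)
∣p─q∣+∣q∣≡∣p∪q∣ (outside ∷ p) (outside ∷ q) = ∣p─q∣+∣q∣≡∣p∪q∣ p q
∣p─q∣+∣q∣≡∣p∪q∣ (inside  ∷ p) (inside  ∷ q) = trans (+-suc _ _) (cong suc (∣p─q∣+∣q∣≡∣p∪q∣ p q))
∣p─q∣+∣q∣≡∣p∪q∣ (outside ∷ p) (inside  ∷ q) = trans (+-suc _ _) (cong suc (∣p─q∣+∣q∣≡∣p∪q∣ p q))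

p⊆q⇒∣p─q∣≡0 : p ⊆ q → ∣ p ─ q ∣ ≡ 0
p⊆q⇒∣p─q∣≡0 {p = p} {q = q} p⊆q = +-cancelʳ-≡ ∣ q ∣ ∣ p ─ q ∣ 0 (begin
  ∣ p ─ q ∣ + ∣ q ∣  ≡⟨ ∣p─q∣+∣q∣≡∣p∪q∣ p q ⟩
  ∣ p ∪ q ∣          ≡⟨ cong ∣_∣ (p⊆q⇒p∪q≡q p⊆q) ⟩
  ∣ q ∣              ∎)
  where open ≡-Reasoning

∣p─q∣≡0⇒p⊆q : ∣ p ─ q ∣ ≡ 0 → p ⊆ q
∣p─q∣≡0⇒p⊆q {p = p} {q = q} ∣p─q∣≡0 {x} x∈p with x ∈? q
... | yes x∈q = x∈q
... | no  x∉q = contradiction (subst (1 ≤_) ∣p─q∣≡0 1≤∣p─q∣) λ ()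
  where
  1≤∣p─q∣ : 1 ≤ ∣ p ─ q ∣
  1≤∣p─q∣ = subst (_≤ ∣ p ─ q ∣) (∣⁅x⁆∣≡1 x) (p⊆q⇒∣p∣≤∣q∣ λ {y} y∈⁅x⁆ →
    subst (_∈ p ─ q) (sym (x∈⁅y⁆⇒x≡y x y∈⁅x⁆)) (x∈p∧x∉q⇒x∈p─q x∈p x∉q))

q⊆r⇒∣p─r∣≤∣p─q∣ : q ⊆ r → ∣ p ─ r ∣ ≤ ∣ p ─ q ∣
q⊆r⇒∣p─r∣≤∣p─q∣ {q = q} {r = r} {p = p} q⊆r = begin
  ∣ p ─ r ∣      ≡⟨ cong (λ s → ∣ p ─ s ∣) (p⊆q⇒p∪q≡q q⊆r) ⟨
  ∣ p ─ q ∪ r ∣  ≡⟨ cong ∣_∣ (p─q─r≡p─q∪r p q r) ⟨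
  ∣ p ─ q ─ r ∣  ≤⟨ ∣p─q∣≤∣p∣ (p ─ q) r ⟩
  ∣ p ─ q ∣      ∎
  where open ≤-Reasoning

q⊆r⇒∣p─q∣+∣q∣≤∣p─r∣+∣r∣ : q ⊆ r → ∣ p ─ q ∣ + ∣ q ∣ ≤ ∣ p ─ r ∣ + ∣ r ∣
q⊆r⇒∣p─q∣+∣q∣≤∣p─r∣+∣r∣ {q = q} {r = r} {p = p} q⊆r = begin
  ∣ p ─ q ∣ + ∣ q ∣  ≡⟨ ∣p─q∣+∣q∣≡∣p∪q∣ p q ⟩
  ∣ p ∪ q ∣          ≤⟨ p⊆q⇒∣p∣≤∣q∣ (∪-least (p⊆p∪q r) (⊆-trans q⊆r (q⊆p∪q p r))) ⟩
  ∣ p ∪ r ∣          ≡⟨ ∣p─q∣+∣q∣≡∣p∪q∣ p r ⟨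
  ∣ p ─ r ∣ + ∣ r ∣  ∎
  where open ≤-Reasoning

⊆-⋃ : p ∈ˡ As → p ⊆ ⋃ As
⊆-⋃ (here refl)                = p⊆p∪q _
⊆-⋃ {As = q ∷ As} (there p∈As) = ⊆-trans (⊆-⋃ p∈As) (q⊆p∪q q (⋃ As))

⋃-least : (∀ {p} → p ∈ˡ As → p ⊆ r) → ⋃ As ⊆ r
⋃-least {As = []}     _   x∈⊥ = ⊥-elim (∉⊥ x∈⊥)
⋃-least {As = p ∷ As} sub     = ∪-least (sub (here refl)) (⋃-least (sub ∘ there))

minimumM-nonempty : ∀ {x xs} → x ∈ˡ xs → ∃[ m ] minimumM xs ≡ just m
minimumM-nonempty {xs = y ∷ ys} _ with minimumM ys
... | nothing = y , refl
... | just z  = y ⊓ z , refl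

minimumM-above : ∀ {v m} xs → All (v <_) xs → minimumM xs ≡ just m → v < m
minimumM-above (x ∷ xs) (v<x ∷ v<xs) eq with minimumM xs in eq′
minimumM-above (x ∷ xs) (v<x ∷ v<xs) refl | nothing = v<x
minimumM-above (x ∷ xs) (v<x ∷ v<xs) refl | just y  = ⊓-glb v<x (minimumM-above xs v<xs eq′)

m+o≤n+p⇒p≤o+q⇒m≤n+q : ∀ {m n o p q} → m + o ≤ n + p → p ≤ o + q → m ≤ n + q
m+o≤n+p⇒p≤o+q⇒m≤n+q {m} {n} {o} {p} {q} m+o≤n+p p≤o+q = +-cancelʳ-≤ o m (n + q) (begin
  m + o        ≤⟨ m+o≤n+p ⟩
  n + p        ≤⟨ +-monoʳ-≤ n p≤o+q ⟩
  n + (o + q)  ≡⟨ cong (n +_) (+-comm o q) ⟩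
  n + (q + o)  ≡⟨ +-assoc n q o ⟨
  n + q + o    ∎)
  where open ≤-Reasoning

concat-∷ʳ : {X : Set} (xss : List (List X)) (xs : List X) → concat (xss ∷ʳ xs) ≡ concat xss ++ xs
concat-∷ʳ xss xs = trans (sym (concat-++ xss [ xs ])) (cong (concat xss ++_) (++-identityʳ xs))

nAfter-∷ʳ : ∀ m (h : History n) R → nAfter m (h ∷ʳ R) ≡ nAfter m h / suc (length R)
nAfter-∷ʳ m []      R = refl
nAfter-∷ʳ m (S ∷ h) R = nAfter-∷ʳ (m / suc (length S)) h R

nAfter-≤ : ∀ m (h : History n) → nAfter m h ≤ m
nAfter-≤ m []      = ≤-refl
nAfter-≤ m (S ∷ h) = ≤-trans (nAfter-≤ (m / suc (length S)) h) (m/n≤m m (suc (length S)))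

-- yesQueries h and noQueries h are definitionally answered true h and answered false h.
answered : Bool → History n → List (Subset n)
answered b h = map proj₁ (filter (λ a → proj₂ a Bool.≟ b) (concat h))

∈-answered⁺ : ∀ {b} (h : History n) → (p , b) ∈ˡ concat h → p ∈ˡ answered b h
∈-answered⁺ {b = b} h pb∈h = ∈-map⁺ proj₁ (∈-filter⁺ (λ a → proj₂ a Bool.≟ b) pb∈h refl)

∈-answered⁻ : ∀ {b} (h : History n) → p ∈ˡ answered b h → (p , b) ∈ˡ concat h
∈-answered⁻ {b = b} h p∈ with ∈-map⁻ proj₁ p∈
... | (p , c) , pc∈ , refl with ∈-filter⁻ (λ a → proj₂ a Bool.≟ b) {xs = concat h} pc∈
...   | pc∈h , refl = pc∈h

module _ {b : Bool} (h : History n) (R : Round n) where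

  answered-∷ʳ⁺ˡ : p ∈ˡ answered b h → p ∈ˡ answered b (h ∷ʳ R)
  answered-∷ʳ⁺ˡ p∈ =
    ∈-answered⁺ (h ∷ʳ R) (subst (_ ∈ˡ_) (sym (concat-∷ʳ h R)) (∈-++⁺ˡ (∈-answered⁻ h p∈)))

  answered-∷ʳ⁺ʳ : (p , b) ∈ˡ R → p ∈ˡ answered b (h ∷ʳ R)
  answered-∷ʳ⁺ʳ pb∈R =
    ∈-answered⁺ (h ∷ʳ R) (subst (_ ∈ˡ_) (sym (concat-∷ʳ h R)) (∈-++⁺ʳ (concat h) pb∈R))

  answered-∷ʳ⁻ : p ∈ˡ answered b (h ∷ʳ R) → p ∈ˡ answered b h ⊎ (p , b) ∈ˡ R
  answered-∷ʳ⁻ p∈ with ∈-++⁻ (concat h) (subst (_ ∈ˡ_) (concat-∷ʳ h R) (∈-answered⁻ (h ∷ʳ R) p∈))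
  ... | inj₁ pb∈h = inj₁ (∈-answered⁺ h pb∈h)
  ... | inj₂ pb∈R = inj₂ pb∈R

uncovered : Subset n → List (Subset n) → ℕ
uncovered U []       = 0
uncovered U (A ∷ As) = 1 ⊓ ∣ A ─ U ∣ + uncovered U As

uncovered≤length : ∀ (U : Subset n) As → uncovered U As ≤ length As
uncovered≤length U []       = z≤n
uncovered≤length U (A ∷ As) = +-mono-≤ (m⊓n≤m 1 _) (uncovered≤length U As)

uncovered-antimono : q ⊆ r → ∀ (As : List (Subset n)) → uncovered r As ≤ uncovered q As
uncovered-antimono q⊆r []       = z≤n
uncovered-antimono q⊆r (A ∷ As) =
  +-mono-≤ (⊓-monoʳ-≤ 1 (q⊆r⇒∣p─r∣≤∣p─q∣ {p = A} q⊆r)) (uncovered-antimono q⊆r As)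

uncovered-< : q ⊆ r → p ∈ˡ As → 0 < ∣ p ─ q ∣ → p ⊆ r → uncovered r As < uncovered q As
uncovered-< {q = q} {r = r} {p = p} {As = p ∷ As} q⊆r (here refl) 0<∣p─q∣ p⊆r = begin-strict
  uncovered r (p ∷ As)   ≡⟨ cong (λ k → 1 ⊓ k + uncovered r As) (p⊆q⇒∣p─q∣≡0 p⊆r) ⟩
  uncovered r As         <⟨ s≤s (uncovered-antimono q⊆r As) ⟩
  1 + uncovered q As     ≡⟨ cong (_+ uncovered q As) (1⊓-positive 0<∣p─q∣) ⟨
  uncovered q (p ∷ As)   ∎
  where
  open ≤-Reasoning
  1⊓-positive : ∀ {k} → 0 < k → 1 ⊓ k ≡ 1
  1⊓-positive {suc k} _ = refl
uncovered-< {q = q} {r = r} {As = A ∷ As} q⊆r (there p∈As) 0<∣p─q∣ p⊆r =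
  +-mono-≤-< (⊓-monoʳ-≤ 1 (q⊆r⇒∣p─r∣≤∣p─q∣ {p = A} q⊆r)) (uncovered-< q⊆r p∈As 0<∣p─q∣ p⊆r)

module _ (d : ℕ) (F : List (Subset n)) where

  Closed : Subset n → Set
  Closed U = ∀ {A} → A ∈ˡ F → ∣ A ─ U ∣ ≤ d → A ⊆ U

  Extendable : Subset n → Set
  Extendable U = ∃[ A ] (A ∈ˡ F × 0 < ∣ A ─ U ∣ × ∣ A ─ U ∣ ≤ d)

  closed-or-extendable : ∀ U → Closed U ⊎ Extendable U
  closed-or-extendable U with any? (λ A → 0 <? ∣ A ─ U ∣ ×-dec ∣ A ─ U ∣ ≤? d) F
  ... | yes extendable = inj₂ (find extendable)
  ... | no  closed     = inj₁ λ A∈F ∣A─U∣≤d →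
    ∣p─q∣≡0⇒p⊆q (n≤0⇒n≡0 (≮⇒≥ λ 0<∣A─U∣ → closed (lose A∈F (0<∣A─U∣ , ∣A─U∣≤d))))

  extend : ∀ {U} → Extendable U →
           ∃[ U′ ] (U ⊆ U′ × ∣ U′ ∣ + d * uncovered U′ F ≤ ∣ U ∣ + d * uncovered U F
                          × uncovered U′ F < uncovered U F)
  extend {U} (A , A∈F , 0<∣A─U∣ , ∣A─U∣≤d) = A ∪ U , q⊆p∪q A U , cost , fewer
    where
    c′ : ℕ
    c′ = uncovered (A ∪ U) F

    fewer : c′ < uncovered U F
    fewer = uncovered-< (q⊆p∪q A U) A∈F 0<∣A─U∣ (p⊆p∪q U)

    cost : ∣ A ∪ U ∣ + d * c′ ≤ ∣ U ∣ + d * uncovered U F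
    cost = begin
      ∣ A ∪ U ∣ + d * c′          ≡⟨ cong (_+ d * c′) (∣p─q∣+∣q∣≡∣p∪q∣ A U) ⟨
      ∣ A ─ U ∣ + ∣ U ∣ + d * c′  ≤⟨ +-monoˡ-≤ (d * c′) (+-monoˡ-≤ ∣ U ∣ ∣A─U∣≤d) ⟩
      d + ∣ U ∣ + d * c′          ≡⟨ cong (_+ d * c′) (+-comm d ∣ U ∣) ⟩
      ∣ U ∣ + d + d * c′          ≡⟨ +-assoc ∣ U ∣ d (d * c′) ⟩
      ∣ U ∣ + (d + d * c′)        ≡⟨ cong (∣ U ∣ +_) (*-suc d c′) ⟨
      ∣ U ∣ + d * suc c′          ≤⟨ +-monoʳ-≤ ∣ U ∣ (*-monoʳ-≤ d fewer) ⟩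
      ∣ U ∣ + d * uncovered U F   ∎
      where open ≤-Reasoning

  close : ∀ fuel U → uncovered U F ≤ fuel →
          ∃[ V ] (U ⊆ V × ∣ V ∣ + d * uncovered V F ≤ ∣ U ∣ + d * uncovered U F × Closed V)
  close fuel U bounded with closed-or-extendable U
  ... | inj₁ closed = U , ⊆-refl , ≤-refl , closed
  ... | inj₂ extendable with extend extendable | fuel
  ...   | U′ , U⊆U′ , cost′ , fewer | zero     = ⊥-elim (n≮0 (<-≤-trans fewer bounded))
  ...   | U′ , U⊆U′ , cost′ , fewer | suc fuel with close fuel U′ (≤-pred (<-≤-trans fewer bounded))
  ...     | V , U′⊆V , cost , closed = V , ⊆-trans U⊆U′ U′⊆V , ≤-trans cost cost′ , closed

  closure : ∀ G → ∃[ U ] (G ⊆ U × ∣ U ∣ ≤ ∣ G ∣ + d * length F × Closed U)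
  closure G with close (length F) G (uncovered≤length G F)
  ... | U , G⊆U , cost , closed = U , G⊆U , ∣U∣≤ , closed
    where
    ∣U∣≤ : ∣ U ∣ ≤ ∣ G ∣ + d * length F
    ∣U∣≤ = ≤-trans (m≤m+n ∣ U ∣ _)
             (≤-trans cost (+-monoʳ-≤ ∣ G ∣ (*-monoʳ-≤ d (uncovered≤length G F))))

does-true : ∀ {P : Set} (P? : Dec P) → does P? ≡ true → P
does-true (yes p) _ = p

does-false : ∀ {P : Set} (P? : Dec P) → does P? ≡ false → ¬ P
does-false (no ¬p) _ = ¬p

module Strategy (n : ℕ) where

  record Invariant (h : History n) : Set where
    field
      yes-large        : ∀ {B} → B ∈ˡ yesQueries h → nAfter n h < ∣ B ─ Gset h ∣
      some-yes-or-few  : (∃[ B ] B ∈ˡ yesQueries h) ⊎ (AllNo h × ∣ Gset h ∣ ≤ n ∸ nAfter n h)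
  open Invariant

  invariant-[] : Invariant []
  invariant-[] = record
    { yes-large       = λ ()
    ; some-yes-or-few = inj₂ ([] , subst (_≤ n ∸ n) (sym (∣⊥∣≡0 n)) z≤n)
    }

  Invariant⇒Good : ∀ {h} → Invariant h → Good n h
  Invariant⇒Good {h} inv with some-yes-or-few inv
  ... | inj₂ few = inj₂ few
  ... | inj₁ (B , B∈yes) with minimumM-nonempty (∈-map⁺ ∣_∣ (∈-map⁺ (_─ Gset h) B∈yes))
  ...   | m , min≡m = inj₁ (m , min≡m , minimumM-above _ above min≡m)
    where
    above : All (nAfter n h <_) (map ∣_∣ (calG h))
    above = map⁺ (map⁺ (All.tabulate (yes-large inv)))

  module Response (h : History n) (F : List (Subset n)) where

    k v d : ℕ
    k = length F
    v = nAfter n h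
    d = v / suc k

    G : Subset n
    G = Gset h

    hull : Subset n
    hull = proj₁ (closure d F G)

    answer : Subset n → Bool
    answer A = does (d <? ∣ A ─ hull ∣)

    round : Round n
    round = map (λ A → A , answer A) F

    answers : Vec Bool k
    answers = Vec.map answer (fromList F)

    zip-answers : zip F (toList answers) ≡ round
    zip-answers = trans (cong (zip F) (trans (toList-map answer (fromList F))
                                             (cong (map answer) (toList∘fromList F))))
                        (zip-map-self F)
      where
      zip-map-self : ∀ As → zip As (map answer As) ≡ map (λ A → A , answer A) As
      zip-map-self []       = refl
      zip-map-self (A ∷ As) = cong ((A , answer A) ∷_) (zip-map-self As)

    h′ : History n
    h′ = h ∷ʳ round

    G′ : Subset n
    G′ = Gset h′

    ∈-round⁻ : ∀ {A b} → (A , b) ∈ˡ round → A ∈ˡ F × answer A ≡ b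
    ∈-round⁻ A∈ with ∈-map⁻ (λ A → A , answer A) A∈
    ... | A , A∈F , refl = A∈F , refl

    nAfter-round : nAfter n h′ ≡ d
    nAfter-round = trans (nAfter-∷ʳ n h round) (cong (λ l → v / suc l) (length-map _ F))

    d+dk≤v : d + d * k ≤ v
    d+dk≤v = subst (_≤ v) (*-suc d k) (m/n*n≤m v (suc k))

    G⊆hull : G ⊆ hull
    G⊆hull = proj₁ (proj₂ (closure d F G))

    ∣hull∣≤ : ∣ hull ∣ ≤ ∣ G ∣ + d * k
    ∣hull∣≤ = proj₁ (proj₂ (proj₂ (closure d F G)))

    hull-closed : Closed d F hull
    hull-closed = proj₂ (proj₂ (proj₂ (closure d F G)))

    G⊆G′ : G ⊆ G′
    G⊆G′ = ⋃-least λ A∈no → ⊆-⋃ (answered-∷ʳ⁺ˡ h round A∈no)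

    G′⊆hull : G′ ⊆ hull
    G′⊆hull = ⋃-least no⊆hull
      where
      no⊆hull : ∀ {A} → A ∈ˡ noQueries h′ → A ⊆ hull
      no⊆hull A∈no with answered-∷ʳ⁻ h round A∈no
      ... | inj₁ A∈old = ⊆-trans (⊆-⋃ A∈old) G⊆hull
      ... | inj₂ A∈round with ∈-round⁻ A∈round
      ...   | A∈F , said-no = hull-closed A∈F (≮⇒≥ (does-false (d <? _) said-no))

    ∣G′∣≤ : ∣ G′ ∣ ≤ ∣ G ∣ + d * k
    ∣G′∣≤ = ≤-trans (p⊆q⇒∣p∣≤∣q∣ G′⊆hull) ∣hull∣≤

    yes-large′ : Invariant h → ∀ {B} → B ∈ˡ yesQueries h′ → d < ∣ B ─ G′ ∣
    yes-large′ inv {B} B∈ with answered-∷ʳ⁻ h round B∈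
    ... | inj₁ B∈old = +-cancelʳ-< (d * k) d ∣ B ─ G′ ∣ (begin-strict
      d + d * k            ≤⟨ d+dk≤v ⟩
      v                    <⟨ yes-large inv B∈old ⟩
      ∣ B ─ G ∣            ≤⟨ m+o≤n+p⇒p≤o+q⇒m≤n+q (q⊆r⇒∣p─q∣+∣q∣≤∣p─r∣+∣r∣ {p = B} G⊆G′) ∣G′∣≤ ⟩
      ∣ B ─ G′ ∣ + d * k   ∎)
      where open ≤-Reasoning
    ... | inj₂ B∈round with ∈-round⁻ B∈round
    ...   | _ , said-yes =
      ≤-trans (does-true (d <? ∣ B ─ hull ∣) said-yes) (q⊆r⇒∣p─r∣≤∣p─q∣ {p = B} G′⊆hull)

    few′ : ∣ G ∣ ≤ n ∸ v → ∣ G′ ∣ ≤ n ∸ d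
    few′ few = m+n≤o⇒m≤o∸n ∣ G′ ∣ (begin
      ∣ G′ ∣ + d            ≤⟨ +-monoˡ-≤ d ∣G′∣≤ ⟩
      ∣ G ∣ + d * k + d     ≡⟨ +-assoc ∣ G ∣ (d * k) d ⟩
      ∣ G ∣ + (d * k + d)   ≡⟨ cong (∣ G ∣ +_) (+-comm (d * k) d) ⟩
      ∣ G ∣ + (d + d * k)   ≤⟨ +-mono-≤ few d+dk≤v ⟩
      n ∸ v + v             ≡⟨ m∸n+n≡m (nAfter-≤ n h) ⟩
      n                     ∎)
      where open ≤-Reasoning

    some-yes-or-few′ : Invariant h → (∃[ B ] B ∈ˡ yesQueries h′) ⊎ (AllNo h′ × ∣ G′ ∣ ≤ n ∸ d)
    some-yes-or-few′ inv with some-yes-or-few inv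
    ... | inj₁ (B , B∈) = inj₁ (B , answered-∷ʳ⁺ˡ h round B∈)
    ... | inj₂ (all-no , few) with any? (λ A → answer A Bool.≟ true) F
    ...   | yes some with find some
    ...     | A , A∈F , said-yes = inj₁ (A , answered-∷ʳ⁺ʳ h round A-yes)
      where
      A-yes : (A , true) ∈ˡ round
      A-yes = subst (λ b → (A , b) ∈ˡ round) said-yes (∈-map⁺ (λ A → A , answer A) A∈F)
    some-yes-or-few′ inv | inj₂ (all-no , few) | no none =
      inj₂ (∷ʳ⁺ all-no (map⁺ (All.tabulate λ A∈F → ¬-not (none ∘ lose A∈F))) , few′ few)

    invariant-∷ʳ : Invariant h → Invariant h′
    invariant-∷ʳ inv = record
      { yes-large       = λ {B} B∈ → subst (_< ∣ B ─ G′ ∣) (sym nAfter-round) (yes-large′ inv B∈)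
      ; some-yes-or-few = subst (λ m → (∃[ B ] B ∈ˡ yesQueries h′) ⊎ (AllNo h′ × ∣ G′ ∣ ≤ n ∸ m))
                                (sym nAfter-round) (some-yes-or-few′ inv)
      }

  adversary-wins : ∀ rounds (h : History n) → Invariant h → AdvWins n h rounds
  adversary-wins zero         _ _   = tt
  adversary-wins (suc rounds) h inv F _ =
    answers , subst (λ R → Good n (h ∷ʳ R) × AdvWins n (h ∷ʳ R) rounds) (sym zip-answers)
                    (Invariant⇒Good inv′ , adversary-wins rounds h′ inv′)
    where
    open Response h F
    inv′ : Invariant h′
    inv′ = invariant-∷ʳ inv

lemma2p1 : (r n : ℕ) → 2 ≤ r → 1 ≤ n → AdvWins n [] (r ∸ 1)
lemma2p1 r n _ _ = Strategy.adversary-wins n (r ∸ 1) [] (Strategy.invariant-[] n)
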